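{- Let $G$ and $H$ be disjoint graphs with ${\rm mdim}(G)=n(G)$ and ${\rm mdim}(H)=n(H)$. Let $e_G=gg'\in E(G)$ be an edge such that $g$ is a maximal neighbor of $g'$ and $g'$ is a maximal neighbor of $g$ in $G$, and let $e_H=hh'\in E(H)$ be an edge such that $h$ is a maximal neighbor of $h'$ and $h'$ is a maximal neighbor of $h$ in $H$. Let $A(G,e_G;H,e_H)$ be the graph obtained from the disjoint union of $G$ and $H$ by identifying the edge $e_G$ with the edge $e_H$ (in either of the two possible ways). Then ${\rm mdim}(A(G,e_G;H,e_H))=n(A(G,e_G;H,e_H))$.
   Context: All graphs are finite, simple and connected; $n(G)=|V(G)|$. A neighbor $y$ of a vertex $x$ is a maximal neighbor of $x$ if $y$ is adjacent to all neighbors of $x$ other than $y$ (i.e., $N_G(x)\subseteq N_G[y]$). For vertices $u,v$, $d_G(u,v)$ is the shortest-path distance; for an edge $x=ww'$ and a vertex $v$, $d_G(x,v)=\min\{d_G(w,v),d_G(w',v)\}$. A vertex $v$ resolves two elements $x,y\in V(G)\cup E(G)$ if $d_G(x,v)\ne d_G(y,v)$. A set $W\subseteq V(G)$ is a mixed resolving set of $G$ if every two distinct elements of $V(G)\cup E(G)$ are resolved by some vertex of $W$. The mixed metric dimension ${\rm mdim}(G)$ is the minimum cardinality of a mixed resolving set of $G$. -}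

module Defs where

open import Data.Nat using (ℕ; zero; suc; _<_; _≤_; _⊓_)
open import Data.Fin using (Fin)
open import Data.Fin.Subset using (Subset; _∈_; ∣_∣)
open import Data.Bool using (Bool; true; false)
open import Data.Product using (Σ; ∃; ∃-syntax; _×_; _,_; proj₁; proj₂)
open import Data.Sum using (_⊎_; inj₁; inj₂)
open import Data.Empty using (⊥)
open import Relation.Nullary using (¬_)
open import Relation.Binary.PropositionalEquality using (_≡_; _≢_)

record Graph (n : ℕ) : Set where
  field
    adj     : Fin n → Fin n → Bool
    adj-sym : ∀ x y → adj x y ≡ adj y x
    adj-irr : ∀ x → adj x x ≡ false

open Graph public

Adj : ∀ {n} → Graph n → Fin n → Fin n → Set
Adj G x y = adj G x y ≡ true

data Walk {n : ℕ} (G : Graph n) : Fin n → Fin n → ℕ → Set where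
  here : ∀ {u} → Walk G u u 0
  step : ∀ {u w v k} → Adj G u w → Walk G w v k → Walk G u v (suc k)

Connected : ∀ {n} → Graph n → Set
Connected {n} G = ∀ (u v : Fin n) → ∃[ k ] Walk G u v k

Dist : ∀ {n} → Graph n → Fin n → Fin n → ℕ → Set
Dist G u v k = Walk G u v k × (∀ m → m < k → ¬ Walk G u v m)

MaximalNeighbor : ∀ {n} → Graph n → (y x : Fin n) → Set
MaximalNeighbor {n} G y x =
  Adj G x y × (∀ (z : Fin n) → Adj G x z → z ≢ y → Adj G y z)

-- elements of V(G) ∪ E(G); an edge is given by an (ordered) pair of adjacent
-- vertices, and ww' and w'w denote the same element (see SameElem)
Elem : ∀ {n} → Graph n → Set
Elem {n} G = Fin n ⊎ Σ (Fin n × Fin n) (λ p → Adj G (proj₁ p) (proj₂ p))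

SameElem : ∀ {n} (G : Graph n) → Elem G → Elem G → Set
SameElem G (inj₁ u) (inj₁ u') = u ≡ u'
SameElem G (inj₁ _) (inj₂ _) = ⊥
SameElem G (inj₂ _) (inj₁ _) = ⊥
SameElem G (inj₂ ((a , b) , _)) (inj₂ ((a' , b') , _)) =
  (a ≡ a' × b ≡ b') ⊎ (a ≡ b' × b ≡ a')

ElemDist : ∀ {n} (G : Graph n) → Elem G → Fin n → ℕ → Set
ElemDist G (inj₁ u) v k = Dist G u v k
ElemDist G (inj₂ ((a , b) , _)) v k =
  ∃[ ka ] ∃[ kb ] (Dist G a v ka × Dist G b v kb × k ≡ ka ⊓ kb)

Resolves : ∀ {n} (G : Graph n) → Fin n → Elem G → Elem G → Set
Resolves G v x y = ∀ k l → ElemDist G x v k → ElemDist G y v l → k ≢ l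

MixedResolving : ∀ {n} (G : Graph n) → Subset n → Set
MixedResolving {n} G W =
  ∀ (x y : Elem G) → ¬ SameElem G x y → ∃[ v ] (v ∈ W × Resolves G v x y)

MDim : ∀ {n} → Graph n → ℕ → Set
MDim {n} G k =
  (∃[ W ] (MixedResolving G W × ∣ W ∣ ≡ k))
  × (∀ (W : Subset n) → MixedResolving G W → k ≤ ∣ W ∣)

-- A (on Fin m) is the graph obtained from the disjoint union of G and H by
-- identifying g with h and g' with h'; ιG, ιH are the embeddings of G and H.
record IsEdgeAmalgam {nG nH m : ℕ} (G : Graph nG) (g g' : Fin nG)
                     (H : Graph nH) (h h' : Fin nH) (A : Graph m)
                     (ιG : Fin nG → Fin m) (ιH : Fin nH → Fin m) : Set where
  field
    injG    : ∀ x y → ιG x ≡ ιG y → x ≡ y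
    injH    : ∀ x y → ιH x ≡ ιH y → x ≡ y
    glue₁   : ιG g ≡ ιH h
    glue₂   : ιG g' ≡ ιH h'
    overlapGH : ∀ x y → ιG x ≡ ιH y → (x ≡ g × y ≡ h) ⊎ (x ≡ g' × y ≡ h')
    cover   : ∀ (a : Fin m) → (∃[ x ] ιG x ≡ a) ⊎ (∃[ y ] ιH y ≡ a)
    adj⇒    : ∀ (a b : Fin m) → Adj A a b →
                (∃[ x ] ∃[ y ] (ιG x ≡ a × ιG y ≡ b × Adj G x y))
                ⊎ (∃[ x ] ∃[ y ] (ιH x ≡ a × ιH y ≡ b × Adj H x y))
    adjG    : ∀ x y → Adj G x y → Adj A (ιG x) (ιG y)
    adjH    : ∀ x y → Adj H x y → Adj A (ιH x) (ιH y)

{-# OPTIONS --safe #-}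
-- A vertex v with a maximal neighbour u lies in every mixed resolving set: any
-- vertex w ≠ v is at least as close to u as to v, hence sees u and the edge uv
-- at the same distance. Conversely, if v has no maximal neighbour then V ∖ {v}
-- is already mixed resolving, so mdim G = n(G) forces every vertex to have a
-- maximal neighbour. In the edge amalgamation every vertex keeps a maximal
-- neighbour: away from the glued edge neighbourhoods do not change, and at the
-- glued edge the two ends are maximal neighbours of each other on both sides.
module Submission where

open import Defs
open import Data.Fin using (Fin; _≟_)
open import Data.Fin.Properties using (any?; all?; ¬∀⟶∃¬)
open import Data.Fin.Subset using (Subset; _∈_; _∉_; ∣_∣; ⊤; ∁; ⁅_⁆)
open import Data.Fin.Subset.Properties
  using (∈⊤; _∈?_; ∣⊤∣≡n; ∣p∣≡n⇒p≡⊤; ∣p∣≤n; p⊆q⇒∣p∣≤∣q∣; x∈⁅x⁆; x∈⁅y⁆⇒x≡y; x∈∁p⇒x∉p; x∉∁p⇒x∈p; x∉p⇒x∈∁p)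
open import Data.Nat using (ℕ; zero; suc; _<_; _≤_; _⊓_; _+_; z≤n; s≤s)
open import Data.Nat.Properties
  using (≤-refl; ≤-trans; ≤-antisym; ≮⇒≥; n≤1+n; anyUpTo?; m≤n⇒m⊓n≡m; m⊓n≤m; m⊓n≤n; n≤0⇒n≡0; ⊓-comm; ⊓-sel)
open import Data.Nat.Induction using (<-wellFounded)
open import Induction.WellFounded using (Acc; acc)
open import Data.Bool using (true)
import Data.Bool.Properties as Bool
open import Data.Product using (∃-syntax; _×_; _,_; proj₁; proj₂) renaming (swap to ×-swap)
open import Data.Sum using (_⊎_; inj₁; inj₂) renaming (swap to ⊎-swap; map to ⊎-map)
open import Data.Empty using (⊥-elim)
open import Relation.Nullary using (¬_; Dec; yes; no)
open import Relation.Nullary.Decidable using (_×-dec_; _⊎-dec_; _→-dec_; ¬?)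
open import Relation.Binary.PropositionalEquality using (_≡_; _≢_; refl; sym; trans; subst)

module _ {n : ℕ} (G : Graph n) where

  adj? : ∀ x y → Dec (Adj G x y)
  adj? x y = adj G x y Bool.≟ true

  Adj-irrefl : ∀ {x y} → Adj G x y → x ≢ y
  Adj-irrefl {x} xy refl with trans (sym xy) (adj-irr G x)
  ... | ()

  Adj-sym : ∀ {x y} → Adj G x y → Adj G y x
  Adj-sym {x} {y} xy = trans (adj-sym G y x) xy

  walk₀⇒≡ : ∀ {u v} → Walk G u v 0 → u ≡ v
  walk₀⇒≡ here = refl

  walk₁⇒adj : ∀ {u v} → Walk G u v 1 → Adj G u v
  walk₁⇒adj (step uv here) = uv

  dist≡0⇒≡ : ∀ {u v} → Dist G u v 0 → u ≡ v
  dist≡0⇒≡ d = walk₀⇒≡ (proj₁ d)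

  dist-refl : ∀ {u k} → Dist G u u k → k ≡ 0
  dist-refl {k = zero}  _ = refl
  dist-refl {k = suc k} d = ⊥-elim (proj₂ d 0 (s≤s z≤n) here)

  dist-adj : ∀ {u v k} → Adj G u v → Dist G u v k → k ≤ 1
  dist-adj {k = zero}        _  _ = z≤n
  dist-adj {k = suc zero}    _  _ = ≤-refl
  dist-adj {k = suc (suc k)} uv d = ⊥-elim (proj₂ d 1 (s≤s (s≤s z≤n)) (step uv here))

  dist-nonadj : ∀ {u v k} → u ≢ v → ¬ Adj G u v → Dist G u v k → 2 ≤ k
  dist-nonadj {k = zero}        u≢v _   d = ⊥-elim (u≢v (dist≡0⇒≡ d))
  dist-nonadj {k = suc zero}    _   ¬uv d = ⊥-elim (¬uv (walk₁⇒adj (proj₁ d)))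
  dist-nonadj {k = suc (suc k)} _   _   _ = s≤s (s≤s z≤n)

  dist≤walk : ∀ {u v k j} → Dist G u v k → Walk G u v j → k ≤ j
  dist≤walk d w = ≮⇒≥ (λ j<k → proj₂ d _ j<k w)

  walk? : ∀ k u v → Dec (Walk G u v k)
  walk? zero u v with u ≟ v
  ... | yes refl = yes here
  ... | no u≢v   = no (λ w → u≢v (walk₀⇒≡ w))
  walk? (suc k) u v with any? (λ x → adj? u x ×-dec walk? k x v)
  ... | yes (x , ux , w) = yes (step ux w)
  ... | no ¬w            = no λ { (step ux w) → ¬w (_ , ux , w) }

  shortest-walk : ∀ {u v k} → Walk G u v k → ∃[ j ] Dist G u v j
  shortest-walk {u} {v} {k} = go (<-wellFounded k)
    where
    go : ∀ {k} → Acc _<_ k → Walk G u v k → ∃[ j ] Dist G u v j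
    go {k} (acc shorter) w with anyUpTo? (λ j → walk? j u v) k
    ... | yes (j , j<k , w′) = go (shorter j<k) w′
    ... | no ¬w              = k , w , λ j j<k w′ → ¬w (j , j<k , w′)

  distance : Connected G → ∀ u v → ∃[ k ] Dist G u v k
  distance conn u v = shortest-walk (proj₂ (conn u v))

  vertex : Fin n → Elem G
  vertex = inj₁

  edge : ∀ {a b} → Adj G a b → Elem G
  edge {a} {b} ab = inj₂ ((a , b) , ab)

  Incident : Elem G → Fin n → Set
  Incident (inj₁ x)              w = x ≡ w
  Incident (inj₂ ((a , b) , _)) w = a ≡ w ⊎ b ≡ w

  incident? : ∀ X w → Dec (Incident X w)
  incident? (inj₁ x)              w = x ≟ w
  incident? (inj₂ ((a , b) , _)) w = a ≟ w ⊎-dec b ≟ w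

  elemDist-incident : ∀ X {w k} → Incident X w → ElemDist G X w k → k ≡ 0
  elemDist-incident (inj₁ x) refl d = dist-refl d
  elemDist-incident (inj₂ _) (inj₁ refl) (ka , kb , da , _ , refl) =
    n≤0⇒n≡0 (subst (ka ⊓ kb ≤_) (dist-refl da) (m⊓n≤m ka kb))
  elemDist-incident (inj₂ _) (inj₂ refl) (ka , kb , _ , db , refl) =
    n≤0⇒n≡0 (subst (ka ⊓ kb ≤_) (dist-refl db) (m⊓n≤n ka kb))

  elemDist-nonincident : ∀ X {w k} → ¬ Incident X w → ElemDist G X w k → k ≢ 0
  elemDist-nonincident (inj₁ x) x∉X d refl = x∉X (dist≡0⇒≡ d)
  elemDist-nonincident (inj₂ _) w∉X (ka , kb , da , db , refl) k≡0 with ⊓-sel ka kb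
  ... | inj₁ ≡ka = w∉X (inj₁ (dist≡0⇒≡ (subst (Dist G _ _) (trans (sym ≡ka) k≡0) da)))
  ... | inj₂ ≡kb = w∉X (inj₂ (dist≡0⇒≡ (subst (Dist G _ _) (trans (sym ≡kb) k≡0) db)))

  resolves-sym : ∀ {w} X Y → Resolves G w X Y → Resolves G w Y X
  resolves-sym X Y r k l dY dX k≡l = r l k dX dY (sym k≡l)

  incident-resolves : ∀ X Y {w} → Incident X w → ¬ Incident Y w → Resolves G w X Y
  incident-resolves X Y w∈X w∉Y k l dX dY k≡l =
    elemDist-nonincident Y w∉Y dY (trans (sym k≡l) (elemDist-incident X w∈X dX))

  resolves-edge-flip : ∀ {w a b} X (ab : Adj G a b) (ba : Adj G b a) →
                       Resolves G w X (edge ba) → Resolves G w X (edge ab)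
  resolves-edge-flip X ab ba r k l dX (ka , kb , da , db , refl) =
    r k l dX (kb , ka , db , da , ⊓-comm ka kb)

  far-vertex-resolves-edge : ∀ {c v z} (cv : Adj G c v) → Adj G v z → c ≢ z → ¬ Adj G c z →
                             Resolves G z (vertex c) (edge cv)
  far-vertex-resolves-edge cv vz c≢z ¬cz k l dc (ka , kb , _ , db , refl) k≡l =
    2≰1 (≤-trans (dist-nonadj c≢z ¬cz dc) (subst (_≤ 1) (sym k≡l) (≤-trans (m⊓n≤n ka kb) (dist-adj vz db))))
    where
    2≰1 : ¬ 2 ≤ 1
    2≰1 (s≤s ())

  Private : Elem G → Elem G → Fin n → Set
  Private X Y p = Incident X p × ¬ Incident Y p

  incident-ends⇒same : ∀ {a b} (ab : Adj G a b) Y → Incident Y a → Incident Y b → SameElem G (edge ab) Y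
  incident-ends⇒same ab (inj₁ _) refl refl = ⊥-elim (Adj-irrefl ab refl)
  incident-ends⇒same ab (inj₂ _) (inj₁ refl) (inj₁ refl) = ⊥-elim (Adj-irrefl ab refl)
  incident-ends⇒same ab (inj₂ _) (inj₁ refl) (inj₂ refl) = inj₁ (refl , refl)
  incident-ends⇒same ab (inj₂ _) (inj₂ refl) (inj₁ refl) = inj₂ (refl , refl)
  incident-ends⇒same ab (inj₂ _) (inj₂ refl) (inj₂ refl) = ⊥-elim (Adj-irrefl ab refl)

  sameEdge-sym : ∀ {a b c d} (ab : Adj G a b) (cd : Adj G c d) →
                 SameElem G (edge ab) (edge cd) → SameElem G (edge cd) (edge ab)
  sameEdge-sym _ _ (inj₁ (refl , refl)) = inj₁ (refl , refl)
  sameEdge-sym _ _ (inj₂ (refl , refl)) = inj₂ (refl , refl)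

  edge-private : ∀ {a b} (ab : Adj G a b) Y → ¬ SameElem G (edge ab) Y → ∃[ p ] Private (edge ab) Y p
  edge-private {a} {b} ab Y ab≠Y with incident? Y a | incident? Y b
  ... | no a∉Y  | _       = a , inj₁ refl , a∉Y
  ... | yes _   | no b∉Y  = b , inj₂ refl , b∉Y
  ... | yes a∈Y | yes b∈Y = ⊥-elim (ab≠Y (incident-ends⇒same ab Y a∈Y b∈Y))

  module ResolvingCriterion (W : Subset n)
    (misses-at-most-one : ∀ p q → p ≢ q → p ∈ W ⊎ q ∈ W)
    (end-resolved : ∀ {c d} (cd : Adj G c d) → d ∉ W → ∃[ w ] (w ∈ W × Resolves G w (vertex c) (edge cd)))
    where

    Resolved : Elem G → Elem G → Set
    Resolved X Y = ∃[ w ] (w ∈ W × Resolves G w X Y)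

    private-resolved : ∀ {X Y p q} → Private X Y p → Private Y X q → Resolved X Y
    private-resolved {X} {Y} {p} {q} (p∈X , p∉Y) (q∈Y , q∉X)
      with misses-at-most-one p q (λ { refl → q∉X p∈X })
    ... | inj₁ p∈W = p , p∈W , incident-resolves X Y p∈X p∉Y
    ... | inj₂ q∈W = q , q∈W , resolves-sym Y X (incident-resolves Y X q∈Y q∉X)

    end-edge-resolved : ∀ {c d} (cd : Adj G c d) → Resolved (vertex c) (edge cd)
    end-edge-resolved {c} {d} cd with d ∈? W
    ... | yes d∈W = d , d∈W , resolves-sym (edge cd) (vertex c)
                                (incident-resolves (edge cd) (vertex c) (inj₂ refl) (Adj-irrefl cd))
    ... | no d∉W  = end-resolved cd d∉W

    vertex-edge-resolved : ∀ x {a b} (ab : Adj G a b) → Resolved (vertex x) (edge ab)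
    vertex-edge-resolved x ab with incident? (edge ab) x
    ... | yes (inj₁ refl) = end-edge-resolved ab
    ... | yes (inj₂ refl) with end-edge-resolved (Adj-sym ab)
    ...   | w , w∈W , r = w , w∈W , resolves-edge-flip (vertex x) ab (Adj-sym ab) r
    vertex-edge-resolved x ab | no x∉ab with edge-private ab (vertex x) (λ ())
    ...   | p , p-private = private-resolved {vertex x} {edge ab} (refl , x∉ab) p-private

    mixedResolving : MixedResolving G W
    mixedResolving (inj₁ x) (inj₁ y) x≢y =
      private-resolved {vertex x} {vertex y} (refl , λ y≡x → x≢y (sym y≡x)) (refl , x≢y)
    mixedResolving (inj₁ x) (inj₂ ((a , b) , ab)) _ = vertex-edge-resolved x ab
    mixedResolving (inj₂ ((a , b) , ab)) (inj₁ x) _ with vertex-edge-resolved x ab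
    ... | w , w∈W , r = w , w∈W , resolves-sym (vertex x) (edge ab) r
    mixedResolving (inj₂ ((a , b) , ab)) (inj₂ ((c , d) , cd)) ab≠cd
      with edge-private ab (edge cd) ab≠cd | edge-private cd (edge ab) (λ s → ab≠cd (sameEdge-sym cd ab s))
    ... | p , p-private | q , q-private = private-resolved {edge ab} {edge cd} p-private q-private

  ⊤-mixedResolving : MixedResolving G ⊤
  ⊤-mixedResolving =
    ResolvingCriterion.mixedResolving ⊤ (λ p _ _ → inj₁ ∈⊤) (λ _ d∉⊤ → ⊥-elim (d∉⊤ ∈⊤))

  maximalNeighbor? : ∀ u v → Dec (MaximalNeighbor G u v)
  maximalNeighbor? u v = adj? v u ×-dec all? (λ z → adj? v z →-dec ¬? (z ≟ u) →-dec adj? u z)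

  non-maximal-witness : ∀ {c v} → Adj G v c → ¬ MaximalNeighbor G c v →
                        ∃[ z ] (Adj G v z × z ≢ c × ¬ Adj G c z)
  non-maximal-witness {c} {v} vc c-not-maximal
    with ¬∀⟶∃¬ n _ (λ z → adj? v z →-dec ¬? (z ≟ c) →-dec adj? c z) (λ f → c-not-maximal (vc , f))
  ... | z , ¬closed with adj? v z | z ≟ c | adj? c z
  ...   | yes vz | no z≢c   | no ¬cz = z , vz , z≢c , ¬cz
  ...   | yes _  | no _     | yes cz = ⊥-elim (¬closed λ _ _ → cz)
  ...   | yes _  | yes refl | _      = ⊥-elim (¬closed λ _ z≢z → ⊥-elim (z≢z refl))
  ...   | no ¬vz | _        | _      = ⊥-elim (¬closed λ vz → ⊥-elim (¬vz vz))

  all-but-mixedResolving : ∀ v → ¬ (∃[ u ] MaximalNeighbor G u v) → MixedResolving G (∁ ⁅ v ⁆)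
  all-but-mixedResolving v no-maximal =
    ResolvingCriterion.mixedResolving (∁ ⁅ v ⁆) misses-only-v end-resolved
    where
    missing⇒≡v : ∀ {d} → d ∉ ∁ ⁅ v ⁆ → d ≡ v
    missing⇒≡v d∉ = x∈⁅y⁆⇒x≡y v (x∉∁p⇒x∈p d∉)

    ≢v⇒present : ∀ {d} → d ≢ v → d ∈ ∁ ⁅ v ⁆
    ≢v⇒present d≢v = x∉p⇒x∈∁p (λ d∈⁅v⁆ → d≢v (x∈⁅y⁆⇒x≡y v d∈⁅v⁆))

    misses-only-v : ∀ p q → p ≢ q → p ∈ ∁ ⁅ v ⁆ ⊎ q ∈ ∁ ⁅ v ⁆
    misses-only-v p q p≢q with p ≟ v
    ... | no p≢v  = inj₁ (≢v⇒present p≢v)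
    ... | yes refl = inj₂ (≢v⇒present (λ q≡p → p≢q (sym q≡p)))

    end-resolved : ∀ {c d} (cd : Adj G c d) → d ∉ ∁ ⁅ v ⁆ →
                   ∃[ w ] (w ∈ ∁ ⁅ v ⁆ × Resolves G w (vertex c) (edge cd))
    end-resolved {c} cd d∉ with missing⇒≡v d∉
    ... | refl with non-maximal-witness (Adj-sym cd) (λ c-maximal → no-maximal (c , c-maximal))
    ...   | z , vz , z≢c , ¬cz =
      z , ≢v⇒present (λ z≡v → Adj-irrefl vz (sym z≡v)) ,
      far-vertex-resolves-edge cd vz (λ c≡z → z≢c (sym c≡z)) ¬cz

  full-mdim⇒maximalNeighbor : MDim G n → ∀ v → ∃[ u ] MaximalNeighbor G u v
  full-mdim⇒maximalNeighbor mdim v with any? (λ u → maximalNeighbor? u v)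
  ... | yes found = found
  ... | no none   = ⊥-elim (x∈∁p⇒x∉p v∈W (x∈⁅x⁆ v))
    where
    W : Subset n
    W = ∁ ⁅ v ⁆
    W≡⊤ : W ≡ ⊤
    W≡⊤ = ∣p∣≡n⇒p≡⊤ (≤-antisym (∣p∣≤n W) (proj₂ mdim W (all-but-mixedResolving v none)))
    v∈W : v ∈ W
    v∈W = subst (v ∈_) (sym W≡⊤) ∈⊤

  -- Every path from v to w ≠ v leaves v through a vertex of N(v) ⊆ N[u].
  maximalNeighbor-closer : ∀ {u v w k j} → MaximalNeighbor G u v → v ≢ w →
                           Dist G u w k → Walk G v w j → k ≤ j
  maximalNeighbor-closer u-max v≢w du here = ⊥-elim (v≢w refl)
  maximalNeighbor-closer {u} u-max v≢w du (step {w = x} vx walk) with x ≟ u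
  ... | yes refl = ≤-trans (dist≤walk du walk) (n≤1+n _)
  ... | no x≢u   = dist≤walk du (step (proj₂ u-max x vx x≢u) walk)

  maximalNeighbor⇒∈ : Connected G → ∀ {u v} → MaximalNeighbor G u v →
                      ∀ W → MixedResolving G W → v ∈ W
  maximalNeighbor⇒∈ conn {u} {v} u-max W resolving
    with resolving (vertex u) (edge (Adj-sym (proj₁ u-max))) (λ ())
  ... | w , w∈W , r with w ≟ v
  ...   | yes refl = w∈W
  ...   | no w≢v with distance conn u w | distance conn v w
  ...     | k , du | kv , dv =
    ⊥-elim (r k (k ⊓ kv) du (k , kv , du , dv , refl)
      (sym (m≤n⇒m⊓n≡m (maximalNeighbor-closer u-max (λ v≡w → w≢v (sym v≡w)) du (proj₁ dv)))))

  all-maximalNeighbor⇒full-mdim : Connected G → (∀ v → ∃[ u ] MaximalNeighbor G u v) → MDim G n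
  all-maximalNeighbor⇒full-mdim conn maximal =
    (⊤ , ⊤-mixedResolving , ∣⊤∣≡n n) ,
    λ W resolving → subst (_≤ ∣ W ∣) (∣⊤∣≡n n)
      (p⊆q⇒∣p∣≤∣q∣ {p = ⊤} (λ {v} _ → maximalNeighbor⇒∈ conn (proj₂ (maximal v)) W resolving))

walk-map : ∀ {n m} {G : Graph n} {A : Graph m} (f : Fin n → Fin m) →
           (∀ x y → Adj G x y → Adj A (f x) (f y)) →
           ∀ {x y k} → Walk G x y k → Walk A (f x) (f y) k
walk-map f f-adj here          = here
walk-map f f-adj (step xz walk) = step (f-adj _ _ xz) (walk-map f f-adj walk)

walk-++ : ∀ {m} {A : Graph m} {a b c k l} → Walk A a b k → Walk A b c l → Walk A a c (k + l)
walk-++ here         walk′ = walk′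
walk-++ (step ax walk) walk′ = step ax (walk-++ walk walk′)

module _ {nG nH m : ℕ} {G : Graph nG} {H : Graph nH} {A : Graph m}
         {ιG : Fin nG → Fin m} {ιH : Fin nH → Fin m} where

  amalgam-swapSides : ∀ {g g′ h h′} → IsEdgeAmalgam G g g′ H h h′ A ιG ιH →
                      IsEdgeAmalgam H h h′ G g g′ A ιH ιG
  amalgam-swapSides R = record
    { injG = injH ; injH = injG ; glue₁ = sym glue₁ ; glue₂ = sym glue₂
    ; overlapGH = λ x y ιHx≡ιGy → ⊎-map ×-swap ×-swap (overlapGH y x (sym ιHx≡ιGy))
    ; cover = λ a → ⊎-swap (cover a)
    ; adj⇒ = λ a b ab → ⊎-swap (adj⇒ a b ab)
    ; adjG = adjH ; adjH = adjG }
    where open IsEdgeAmalgam R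

  amalgam-swapEnds : ∀ {g g′ h h′} → IsEdgeAmalgam G g g′ H h h′ A ιG ιH →
                     IsEdgeAmalgam G g′ g H h′ h A ιG ιH
  amalgam-swapEnds R = record
    { injG = injG ; injH = injH ; glue₁ = glue₂ ; glue₂ = glue₁
    ; overlapGH = λ x y ιGx≡ιHy → ⊎-swap (overlapGH x y ιGx≡ιHy)
    ; cover = cover ; adj⇒ = adj⇒ ; adjG = adjG ; adjH = adjH }
    where open IsEdgeAmalgam R

  module _ {g g′ h h′} (R : IsEdgeAmalgam G g g′ H h h′ A ιG ιH) where
    open IsEdgeAmalgam R

    -- N_A(ιG x) is the image of N_G(x) together with the images of N_H(y) for
    -- the y glued to x.
    maximalNeighbor-ιG : ∀ {u x} → MaximalNeighbor G u x →
      (∀ y → ιG x ≡ ιH y → ∃[ y′ ] (ιG u ≡ ιH y′ × MaximalNeighbor H y′ y)) →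
      MaximalNeighbor A (ιG u) (ιG x)
    maximalNeighbor-ιG {u} {x} u-max glued-max = adjG x u (proj₁ u-max) , closed
      where
      closed : ∀ z → Adj A (ιG x) z → z ≢ ιG u → Adj A (ιG u) z
      closed z xz z≢u with adj⇒ (ιG x) z xz
      ... | inj₁ (p , q , ιGp≡ιGx , refl , pq) with injG p x ιGp≡ιGx
      ...   | refl = adjG u q (proj₂ u-max q pq (λ { refl → z≢u refl }))
      closed z xz z≢u | inj₂ (p , q , ιHp≡ιGx , refl , pq) with glued-max p (sym ιHp≡ιGx)
      ...   | y′ , ιGu≡ιHy′ , y′-max =
        subst (λ t → Adj A t (ιH q)) (sym ιGu≡ιHy′)
          (adjH y′ q (proj₂ y′-max q pq (λ { refl → z≢u (sym ιGu≡ιHy′) })))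

    unglued-maximalNeighbor : ∀ {u x} → x ≢ g → x ≢ g′ → MaximalNeighbor G u x →
                              MaximalNeighbor A (ιG u) (ιG x)
    unglued-maximalNeighbor {u} {x} x≢g x≢g′ u-max = maximalNeighbor-ιG u-max glued-max
      where
      glued-max : ∀ y → ιG x ≡ ιH y → ∃[ y′ ] (ιG u ≡ ιH y′ × MaximalNeighbor H y′ y)
      glued-max y ιGx≡ιHy with overlapGH x y ιGx≡ιHy
      ... | inj₁ (x≡g , _)  = ⊥-elim (x≢g x≡g)
      ... | inj₂ (x≡g′ , _) = ⊥-elim (x≢g′ x≡g′)

    glued-maximalNeighbor : MaximalNeighbor G g′ g → MaximalNeighbor H h′ h →
                            MaximalNeighbor A (ιG g′) (ιG g)
    glued-maximalNeighbor g′-max h′-max = maximalNeighbor-ιG g′-max glued-max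
      where
      glued-max : ∀ y → ιG g ≡ ιH y → ∃[ y′ ] (ιG g′ ≡ ιH y′ × MaximalNeighbor H y′ y)
      glued-max y ιGg≡ιHy with overlapGH g y ιGg≡ιHy
      ... | inj₁ (_ , refl)   = h′ , glue₂ , h′-max
      ... | inj₂ (g≡g′ , _) = ⊥-elim (Adj-irrefl G (proj₁ g′-max) g≡g′)

    walk-ιG-ιH : Connected G → Connected H → ∀ x y → ∃[ k ] Walk A (ιG x) (ιH y) k
    walk-ιG-ιH connG connH x y =
      _ , walk-++ (subst (λ t → Walk A (ιG x) t _) glue₁ (walk-map ιG adjG (proj₂ (connG x g))))
                  (walk-map ιH adjH (proj₂ (connH h y)))

module _ {nG nH m : ℕ} {G : Graph nG} {H : Graph nH} {A : Graph m}
         {ιG : Fin nG → Fin m} {ιH : Fin nH → Fin m} {g g′ h h′}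
         (R : IsEdgeAmalgam G g g′ H h h′ A ιG ιH) where
  open IsEdgeAmalgam R

  amalgam-connected : Connected G → Connected H → Connected A
  amalgam-connected connG connH a b with cover a | cover b
  ... | inj₁ (x , refl) | inj₁ (y , refl) = _ , walk-map ιG adjG (proj₂ (connG x y))
  ... | inj₂ (x , refl) | inj₂ (y , refl) = _ , walk-map ιH adjH (proj₂ (connH x y))
  ... | inj₁ (x , refl) | inj₂ (y , refl) = walk-ιG-ιH R connG connH x y
  ... | inj₂ (x , refl) | inj₁ (y , refl) = walk-ιG-ιH (amalgam-swapSides R) connH connG x y

  ιG-maximalNeighbor : MDim G nG → MaximalNeighbor G g g′ → MaximalNeighbor G g′ g →
                       MaximalNeighbor H h h′ → MaximalNeighbor H h′ h →
                       ∀ x → ∃[ u ] MaximalNeighbor A u (ιG x)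
  ιG-maximalNeighbor mdimG g-max g′-max h-max h′-max x with x ≟ g | x ≟ g′
  ... | yes refl | _        = _ , glued-maximalNeighbor R g′-max h′-max
  ... | no _     | yes refl = _ , glued-maximalNeighbor (amalgam-swapEnds R) g-max h-max
  ... | no x≢g   | no x≢g′  =
    _ , unglued-maximalNeighbor R x≢g x≢g′ (proj₂ (full-mdim⇒maximalNeighbor G mdimG x))

amalgam-maximalNeighbor : ∀ {nG nH m} {G : Graph nG} {H : Graph nH} {A : Graph m} {ιG ιH g g′ h h′} →
                          IsEdgeAmalgam G g g′ H h h′ A ιG ιH → MDim G nG → MDim H nH →
                          MaximalNeighbor G g g′ → MaximalNeighbor G g′ g →
                          MaximalNeighbor H h h′ → MaximalNeighbor H h′ h →
                          ∀ a → ∃[ u ] MaximalNeighbor A u a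
amalgam-maximalNeighbor R mdimG mdimH g-max g′-max h-max h′-max a with IsEdgeAmalgam.cover R a
... | inj₁ (x , refl) = ιG-maximalNeighbor R mdimG g-max g′-max h-max h′-max x
... | inj₂ (y , refl) = ιG-maximalNeighbor (amalgam-swapSides R) mdimH h-max h′-max g-max g′-max y

mainTheorem4 : ∀ {nG nH m : ℕ} (G : Graph nG) (H : Graph nH)
    → Connected G → Connected H
    → MDim G nG → MDim H nH
    → (g g' : Fin nG) → MaximalNeighbor G g g' → MaximalNeighbor G g' g
    → (h h' : Fin nH) → MaximalNeighbor H h h' → MaximalNeighbor H h' h
    → (A : Graph m) (ιG : Fin nG → Fin m) (ιH : Fin nH → Fin m)
    → IsEdgeAmalgam G g g' H h h' A ιG ιH
    → MDim A m
mainTheorem4 G H connG connH mdimG mdimH g g' g-max g'-max h h' h-max h'-max A ιG ιH R =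
  all-maximalNeighbor⇒full-mdim A (amalgam-connected R connG connH)
    (amalgam-maximalNeighbor R mdimG mdimH g-max g'-max h-max h'-max)
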